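{- Let $m$ and $p$ be positive integers. Then \[ \sum_{k=1}^{p-1}k^mH_k=\frac{H_{p-1}}{m+1}\sum_{r=0}^m\binom{m+1}{r}B_rp^{m+1-r}-(p-1)B_m-\frac{1}{m+1}\sum_{r=0}^{m-1}\sum_{\lambda=0}^{m-r}\frac{\binom{m+1}{r}\binom{m+1-r}{\lambda}}{m+1-r}B_rB_{\lambda}\,p^{m+1-r-\lambda}. \]
   Context: $H_n=\sum_{i=1}^n 1/i$ for $n\ge 1$ and $H_0=0$ are the harmonic numbers. $B_0,B_1,B_2,\dots$ are the Bernoulli numbers defined by $B_0=1$ and $\sum_{k=0}^n\binom{n+1}{k}B_k=0$ for $n\ge1$ (so $B_1=-1/2$). -}

module Defs where

open import Data.Nat as ℕ using (ℕ; zero; suc)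
open import Data.Nat.Combinatorics using (_C_)
open import Data.Integer using (+_)
open import Data.Rational using (ℚ; 0ℚ; 1ℚ; _+_; _*_; -_; _-_; _/_)
open import Data.Vec using (Vec; []; _∷_; lookup; _∷ʳ_)
open import Data.Fin using (Fin; fromℕ<; toℕ)
open import Data.Nat.Properties using (n<1+n)
import Relation.Nullary

ℕ→ℚ : ℕ → ℚ
ℕ→ℚ n = (+ n) / 1

1/suc : ℕ → ℚ
1/suc n = (+ 1) / suc n

_^ℚ_ : ℚ → ℕ → ℚ
q ^ℚ zero = 1ℚ
q ^ℚ suc n = q * (q ^ℚ n)

Σ< : ℕ → (ℕ → ℚ) → ℚ
Σ< zero f = 0ℚ
Σ< (suc n) f = Σ< n f + f n

-- Σ_{i=a}^{b} f i  (empty if b < a)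
Σ[_to_] : ℕ → ℕ → (ℕ → ℚ) → ℚ
Σ[ a to b ] f = Σ< (suc b ℕ.∸ a) (λ i → f (a ℕ.+ i))

H : ℕ → ℚ
H zero = 0ℚ
H (suc n) = H n + 1/suc n

-- Bernoulli numbers B_0 .. B_n, computed from the defining recurrence
--   B_0 = 1,  Σ_{k=0}^{n} C(n+1,k) B_k = 0 for n ≥ 1,
-- i.e.  B_n = - 1/(n+1) Σ_{k=0}^{n-1} C(n+1,k) B_k  for n ≥ 1.
Bs : (n : ℕ) → Vec ℚ (suc n)
Bs zero = 1ℚ ∷ []
Bs (suc n) = prev ∷ʳ next
  where
  prev : Vec ℚ (suc n)
  prev = Bs n
  get : ℕ → ℚ
  get k with k ℕ.<? suc n
  ... | Relation.Nullary.yes k<  = lookup prev (fromℕ< k<)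
  ... | Relation.Nullary.no _    = 0ℚ
  next : ℚ
  next = - (1/suc (suc n) * Σ< (suc n) (λ k → ℕ→ℚ ((suc (suc n)) C k) * get k))

B : ℕ → ℚ
B n = lookup (Bs n) (fromℕ< (n<1+n n))

module Submission where

-- Write S(k) = Σ_{j<k} j^m.  Abel summation turns the left side into
-- H_{p-1} S(p) - Σ_{i<p-1} S(i+1)/(i+1), using H_{i+1} - H_i = 1/(i+1).  Faulhaber's
-- formula S(n) = Φ_m(n)/(m+1), with Φ_m(y) = Σ_{r ≤ m} C(m+1,r) B_r y^{m+1-r}, gives the
-- first term; since Φ_m(y) is divisible by y, S(i+1)/(i+1) is again a polynomial in i+1,
-- and summing it over i with Faulhaber's formula once more (exponent m - r for r < m;
-- the term r = m is constant) gives the double sum and the term (p-1) B_m.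
--
-- Faulhaber's formula is proved by telescoping the difference equation
-- B_M(x+1) - B_M(x) = M x^{M-1} of the Bernoulli polynomials, which in turn follows
-- from the binomial theorem, the identity C(M,r) C(M-r,j) = C(M,j) C(M-j,r) and the
-- recurrence of the Bernoulli numbers.

open import Defs
open import Data.Nat as ℕ using (ℕ; suc; _∸_; _≥_)
open import Data.Nat.Combinatorics using (_C_)
open import Data.Rational using (ℚ; _+_; _*_; _-_)
open import Relation.Binary.PropositionalEquality using (_≡_)

open import Data.Nat using (zero; s≤s; z≤n; _!)
open import Data.Nat.Combinatorics
  using (nCk≡n!/k![n-k]!; k![n∸k]!∣n!; k>n⇒nCk≡0; nCk+nC[k+1]≡[n+1]C[k+1]; nCk≡nC[n∸k]; nC1≡n; nCn≡1)
open import Data.Nat.DivMod using (m/n*n≡m)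
open import Data.Sum using (inj₁; inj₂)
open import Data.Product using (Σ; _,_; proj₁)
open import Data.Vec using (Vec; []; _∷_; lookup; _∷ʳ_)
open import Data.Fin using (fromℕ<)
open import Data.Rational using (0ℚ; 1ℚ; -_; toℚᵘ)
open import Relation.Binary.PropositionalEquality using (refl; sym; trans; cong; cong₂; subst; module ≡-Reasoning)
open import Relation.Nullary using (yes; no; ¬_)
open import Relation.Nullary.Decidable.Core using (dec⇒maybe)
import Data.Nat.Properties as ℕP
import Data.Nat.Tactic.RingSolver as ℕR
import Data.Integer as ℤ
import Data.Integer.Properties as ℤP
import Data.Integer.Tactic.RingSolver as ℤR
import Data.Rational.Properties as ℚP
import Data.Rational.Unnormalised as ℚᵘ
import Data.Rational.Unnormalised.Properties as ℚᵘP
import Algebra.Properties.Group ℚP.+-0-group as +-Group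
open import Tactic.RingSolver using (solve-∀)
open import Tactic.RingSolver.Core.AlmostCommutativeRing using (AlmostCommutativeRing; fromCommutativeRing)

ℚ-ring : AlmostCommutativeRing _ _
ℚ-ring = fromCommutativeRing ℚP.+-*-commutativeRing (λ x → dec⇒maybe (0ℚ ℚP.≟ x))

Σ-cong : ∀ n {f g : ℕ → ℚ} → (∀ i → i ℕ.< n → f i ≡ g i) → Σ< n f ≡ Σ< n g
Σ-cong zero     eq = refl
Σ-cong (suc n) eq = cong₂ _+_ (Σ-cong n (λ i i<n → eq i (ℕP.m<n⇒m<1+n i<n))) (eq n (ℕP.n<1+n n))

Σ-cong-∀ : ∀ n {f g : ℕ → ℚ} → (∀ i → f i ≡ g i) → Σ< n f ≡ Σ< n g
Σ-cong-∀ n eq = Σ-cong n (λ i _ → eq i)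

Σ-zero : ∀ n (f : ℕ → ℚ) → (∀ i → i ℕ.< n → f i ≡ 0ℚ) → Σ< n f ≡ 0ℚ
Σ-zero n f eq = trans (Σ-cong n eq) (Σ-0 n)
  where
  Σ-0 : ∀ n → Σ< n (λ _ → 0ℚ) ≡ 0ℚ
  Σ-0 zero    = refl
  Σ-0 (suc n) = trans (cong (_+ 0ℚ) (Σ-0 n)) (ℚP.+-identityʳ 0ℚ)

Σ-distrib-+ : ∀ n (f g : ℕ → ℚ) → Σ< n (λ i → f i + g i) ≡ Σ< n f + Σ< n g
Σ-distrib-+ zero    f g = sym (ℚP.+-identityʳ 0ℚ)
Σ-distrib-+ (suc n) f g = trans (cong (_+ (f n + g n)) (Σ-distrib-+ n f g)) (interchange (Σ< n f) (Σ< n g) (f n) (g n))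
  where
  interchange : ∀ (a b c d : ℚ) → (a + b) + (c + d) ≡ (a + c) + (b + d)
  interchange = solve-∀ ℚ-ring

Σ-*ˡ : ∀ n (c : ℚ) (f : ℕ → ℚ) → c * Σ< n f ≡ Σ< n (λ i → c * f i)
Σ-*ˡ zero    c f = ℚP.*-zeroʳ c
Σ-*ˡ (suc n) c f = trans (ℚP.*-distribˡ-+ c (Σ< n f) (f n)) (cong (_+ c * f n) (Σ-*ˡ n c f))

Σ-swap : ∀ a b (f : ℕ → ℕ → ℚ) → Σ< a (λ i → Σ< b (f i)) ≡ Σ< b (λ j → Σ< a (λ i → f i j))
Σ-swap zero    b f = sym (Σ-zero b (λ _ → 0ℚ) (λ _ _ → refl))
Σ-swap (suc a) b f = trans (cong (_+ Σ< b (f a)) (Σ-swap a b f)) (sym (Σ-distrib-+ b _ _))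

Σ-head : ∀ n (f : ℕ → ℚ) → Σ< (suc n) f ≡ f 0 + Σ< n (λ i → f (suc i))
Σ-head zero    f = trans (ℚP.+-identityˡ (f 0)) (sym (ℚP.+-identityʳ (f 0)))
Σ-head (suc n) f = trans (cong (_+ f (suc n)) (Σ-head n f)) (ℚP.+-assoc (f 0) _ (f (suc n)))

Σ-drop-head : ∀ n (f : ℕ → ℚ) → f 0 ≡ 0ℚ → Σ< (suc n) f ≡ Σ< n (λ i → f (suc i))
Σ-drop-head n f f0≡0 = trans (Σ-head n f) (trans (cong (_+ Σ< n (λ i → f (suc i))) f0≡0) (ℚP.+-identityˡ _))

Σ-extend : ∀ n N (f : ℕ → ℚ) → n ℕ.≤ N → (∀ i → n ℕ.≤ i → f i ≡ 0ℚ) → Σ< N f ≡ Σ< n f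
Σ-extend zero zero f _ _ = refl
Σ-extend n (suc N) f n≤1+N vanish with ℕP.m≤n⇒m<n∨m≡n n≤1+N
... | inj₂ refl = refl
... | inj₁ (s≤s n≤N) = trans (cong₂ _+_ (Σ-extend n N f n≤N vanish) (vanish N n≤N)) (ℚP.+-identityʳ (Σ< n f))

Σ-reverse : ∀ n (f : ℕ → ℚ) → Σ< n f ≡ Σ< n (λ i → f (n ∸ suc i))
Σ-reverse zero    f = refl
Σ-reverse (suc n) f = begin
  Σ< n f + f n                                   ≡⟨ cong (_+ f n) (Σ-reverse n f) ⟩
  Σ< n (λ i → f (n ∸ suc i)) + f n               ≡⟨ ℚP.+-comm _ (f n) ⟩
  f n + Σ< n (λ i → f (n ∸ suc i))               ≡⟨ Σ-head n (λ i → f (suc n ∸ suc i)) ⟨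
  Σ< (suc n) (λ i → f (suc n ∸ suc i))           ∎
  where open ≡-Reasoning

abel : ∀ (a h : ℕ → ℚ) → h 0 ≡ 0ℚ → ∀ n →
  Σ< n (λ i → a (suc i) * h (suc i)) ≡ h n * Σ< (suc n) a - Σ< n (λ i → (h (suc i) - h i) * Σ< (suc i) a)
abel a h h0≡0 zero = sym (trans (cong (λ c → c * Σ< 1 a - 0ℚ) h0≡0) (zero-minus-zero (Σ< 1 a)))
  where
  zero-minus-zero : ∀ (x : ℚ) → 0ℚ * x - 0ℚ ≡ 0ℚ
  zero-minus-zero = solve-∀ ℚ-ring
abel a h h0≡0 (suc n) = trans (cong (_+ a (suc n) * h (suc n)) (abel a h h0≡0 n))
  (step (h n) (h (suc n)) (Σ< (suc n) a) (a (suc n)) (Σ< n (λ i → (h (suc i) - h i) * Σ< (suc i) a)))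
  where
  step : ∀ (hₙ hₙ₊₁ A a D : ℚ) → hₙ * A - D + a * hₙ₊₁ ≡ hₙ₊₁ * (A + a) - (D + (hₙ₊₁ - hₙ) * A)
  step = solve-∀ ℚ-ring

ι : ℕ → ℚ
ι = ℕ→ℚ

-- ι n is the normal form of the unnormalised fraction n/1; the
-- homomorphism laws are inherited from unnormalised arithmetic.
ι≃n/1 : ∀ n → toℚᵘ (ι n) ℚᵘ.≃ ℚᵘ.mkℚᵘ (ℤ.+ n) 0
ι≃n/1 n = ℚP.toℚᵘ-fromℚᵘ (ℚᵘ.mkℚᵘ (ℤ.+ n) 0)

ι-+ : ∀ a b → ι (a ℕ.+ b) ≡ ι a + ι b
ι-+ a b = ℚP.toℚᵘ-injective (ℚᵘP.≃-trans (ι≃n/1 (a ℕ.+ b)) (ℚᵘP.≃-trans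
  (ℚᵘ.*≡* (trans (cong (ℤ._* (ℤ.+ 1 ℤ.* ℤ.+ 1)) (ℤP.pos-+ a b)) (sum-over-1 (ℤ.+ a) (ℤ.+ b))))
  (ℚᵘP.≃-sym (ℚᵘP.≃-trans (ℚP.toℚᵘ-homo-+ (ι a) (ι b)) (ℚᵘP.+-cong (ι≃n/1 a) (ι≃n/1 b))))))
  where
  sum-over-1 : ∀ x y → (x ℤ.+ y) ℤ.* (ℤ.+ 1 ℤ.* ℤ.+ 1) ≡ (x ℤ.* ℤ.+ 1 ℤ.+ y ℤ.* ℤ.+ 1) ℤ.* ℤ.+ 1
  sum-over-1 = ℤR.solve-∀

ι-* : ∀ a b → ι (a ℕ.* b) ≡ ι a * ι b
ι-* a b = ℚP.toℚᵘ-injective (ℚᵘP.≃-trans (ι≃n/1 (a ℕ.* b)) (ℚᵘP.≃-trans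
  (ℚᵘ.*≡* (trans (cong (ℤ._* (ℤ.+ 1 ℤ.* ℤ.+ 1)) (ℤP.pos-* a b)) (product-over-1 (ℤ.+ a) (ℤ.+ b))))
  (ℚᵘP.≃-sym (ℚᵘP.≃-trans (ℚP.toℚᵘ-homo-* (ι a) (ι b)) (ℚᵘP.*-cong (ι≃n/1 a) (ι≃n/1 b))))))
  where
  product-over-1 : ∀ x y → (x ℤ.* y) ℤ.* (ℤ.+ 1 ℤ.* ℤ.+ 1) ≡ (x ℤ.* y) ℤ.* ℤ.+ 1
  product-over-1 = ℤR.solve-∀

ι-suc : ∀ n → ι (suc n) ≡ ι n + 1ℚ
ι-suc n = trans (cong ι (ℕP.+-comm 1 n)) (ι-+ n 1)

1/suc-inverse : ∀ n → 1/suc n * ι (suc n) ≡ 1ℚ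
1/suc-inverse n = ℚP.toℚᵘ-injective (ℚᵘP.≃-trans (ℚP.toℚᵘ-homo-* (1/suc n) (ι (suc n)))
  (ℚᵘP.≃-trans (ℚᵘP.*-cong (ℚP.toℚᵘ-fromℚᵘ (ℚᵘ.mkℚᵘ (ℤ.+ 1) n)) (ι≃n/1 (suc n)))
  (ℚᵘ.*≡* (trans (ℤP.*-identityʳ (ℤ.+ 1 ℤ.* ℤ.+ suc n)) (cong (λ k → ℤ.+ 1 ℤ.* ℤ.+ suc k) (sym (ℕP.*-identityʳ n)))))))

1/suc-cancel : ∀ n t → 1/suc n * (ι (suc n) * t) ≡ t
1/suc-cancel n t = begin
  1/suc n * (ι (suc n) * t)  ≡⟨ ℚP.*-assoc (1/suc n) (ι (suc n)) t ⟨
  1/suc n * ι (suc n) * t    ≡⟨ cong (_* t) (1/suc-inverse n) ⟩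
  1ℚ * t                     ≡⟨ ℚP.*-identityˡ t ⟩
  t                          ∎
  where open ≡-Reasoning

ι-cancel : ∀ n t → ι (suc n) * (1/suc n * t) ≡ t
ι-cancel n t = begin
  ι (suc n) * (1/suc n * t)  ≡⟨ ℚP.*-assoc (ι (suc n)) (1/suc n) t ⟨
  ι (suc n) * 1/suc n * t    ≡⟨ cong (_* t) (ℚP.*-comm (ι (suc n)) (1/suc n)) ⟩
  1/suc n * ι (suc n) * t    ≡⟨ ℚP.*-assoc (1/suc n) (ι (suc n)) t ⟩
  1/suc n * (ι (suc n) * t)  ≡⟨ 1/suc-cancel n t ⟩
  t                          ∎
  where open ≡-Reasoning

Σ-const : ∀ n (c : ℚ) → Σ< n (λ _ → c) ≡ ι n * c
Σ-const zero    c = sym (ℚP.*-zeroˡ c)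
Σ-const (suc n) c = begin
  Σ< n (λ _ → c) + c   ≡⟨ cong (_+ c) (Σ-const n c) ⟩
  ι n * c + c          ≡⟨ step (ι n) c ⟩
  (ι n + 1ℚ) * c       ≡⟨ cong (_* c) (ι-suc n) ⟨
  ι (suc n) * c        ∎
  where
  open ≡-Reasoning
  step : ∀ (a c : ℚ) → a * c + c ≡ (a + 1ℚ) * c
  step = solve-∀ ℚ-ring

C-factorial : ∀ {n k} → k ℕ.≤ n → (n C k) ℕ.* (k ! ℕ.* (n ∸ k) !) ≡ n !
C-factorial {n} {k} k≤n =
  trans (cong (ℕ._* (k ! ℕ.* (n ∸ k) !)) (nCk≡n!/k![n-k]! k≤n)) (m/n*n≡m (k![n∸k]!∣n! k≤n))
  where instance _ = k ℕP.!* (n ∸ k) !≢0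

C-C-vanish : ∀ N r j → ¬ (r ℕ.+ j ℕ.≤ N) → (N C r) ℕ.* ((N ∸ r) C j) ≡ 0
C-C-vanish N r j r+j≰N with r ℕ.≤? N
... | no r≰N  = cong (ℕ._* ((N ∸ r) C j)) (k>n⇒nCk≡0 (ℕP.≰⇒> r≰N))
... | yes r≤N = trans (cong ((N C r) ℕ.*_) (k>n⇒nCk≡0 N∸r<j)) (ℕP.*-zeroʳ (N C r))
  where
  N∸r<j : N ∸ r ℕ.< j
  N∸r<j = ℕP.≰⇒> (λ j≤N∸r → r+j≰N (subst (r ℕ.+ j ℕ.≤_) (ℕP.m+[n∸m]≡n r≤N) (ℕP.+-monoʳ-≤ r j≤N∸r)))

-- Both sides count the ways to choose disjoint r- and j-subsets of an N-set:
-- C(N,r) C(N-r,j) = C(N,j) C(N-j,r).  In range, both sides times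
-- r! j! (N-r-j)! equal N!.
C-C-swap : ∀ N r j → (N C r) ℕ.* ((N ∸ r) C j) ≡ (N C j) ℕ.* ((N ∸ j) C r)
C-C-swap N r j with r ℕ.+ j ℕ.≤? N
... | no r+j≰N = trans (C-C-vanish N r j r+j≰N)
                   (sym (C-C-vanish N j r (λ j+r≤N → r+j≰N (subst (ℕ._≤ N) (ℕP.+-comm j r) j+r≤N))))
... | yes r+j≤N = ℕP.*-cancelʳ-≡ _ _ D {{D≢0}} (trans (via r j r+j≤N) (sym (trans (cong ((N C j) ℕ.* ((N ∸ j) C r) ℕ.*_) D-sym) (via j r j+r≤N))))
  where
  j+r≤N : j ℕ.+ r ℕ.≤ N
  j+r≤N = subst (ℕ._≤ N) (ℕP.+-comm r j) r+j≤N
  D : ℕ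
  D = r ! ℕ.* (j ! ℕ.* (N ∸ r ∸ j) !)
  D≢0 : ℕ.NonZero D
  D≢0 = ℕP.m*n≢0 (r !) _ {{r ℕP.!≢0}} {{ℕP.m*n≢0 (j !) _ {{j ℕP.!≢0}} {{(N ∸ r ∸ j) ℕP.!≢0}}}}
  rearrange : ∀ (a b x y z : ℕ) → (a ℕ.* b) ℕ.* (x ℕ.* (y ℕ.* z)) ≡ a ℕ.* (x ℕ.* (b ℕ.* (y ℕ.* z)))
  rearrange = ℕR.solve-∀
  swap-first : ∀ (x y z : ℕ) → x ℕ.* (y ℕ.* z) ≡ y ℕ.* (x ℕ.* z)
  swap-first = ℕR.solve-∀
  D-sym : D ≡ j ! ℕ.* (r ! ℕ.* (N ∸ j ∸ r) !)
  D-sym = trans (swap-first (r !) (j !) ((N ∸ r ∸ j) !))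
    (cong (λ t → j ! ℕ.* (r ! ℕ.* t !)) (trans (ℕP.∸-+-assoc N r j)
      (trans (cong (N ∸_) (ℕP.+-comm r j)) (sym (ℕP.∸-+-assoc N j r)))))
  via : ∀ a b → a ℕ.+ b ℕ.≤ N → (N C a) ℕ.* ((N ∸ a) C b) ℕ.* (a ! ℕ.* (b ! ℕ.* (N ∸ a ∸ b) !)) ≡ N !
  via a b a+b≤N =
    trans (rearrange (N C a) ((N ∸ a) C b) (a !) (b !) ((N ∸ a ∸ b) !))
    (trans (cong (λ t → (N C a) ℕ.* (a ! ℕ.* t)) (C-factorial (ℕP.m+n≤o⇒m≤o∸n b (subst (ℕ._≤ N) (ℕP.+-comm a b) a+b≤N))))
           (C-factorial (ℕP.m+n≤o⇒m≤o a a+b≤N)))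

C-suc-self : ∀ n → suc n C n ≡ suc n
C-suc-self n = trans (nCk≡nC[n∸k] (ℕP.n≤1+n n)) (trans (cong (suc n C_) (ℕP.m+n∸n≡m 1 n)) (nC1≡n (suc n)))

-- The binomial theorem for (x + 1)^e, with the sum over j < K for any K > e
-- (the coefficients C(e,j) vanish for j > e).

binomialSum : ℕ → ℕ → ℚ → ℚ
binomialSum e K x = Σ< K (λ j → ι (e C j) * x ^ℚ j)

-- Pascal's rule, summed.
binomialSum-suc : ∀ e K x → binomialSum (suc e) (suc K) x ≡ x * binomialSum e K x + binomialSum e (suc K) x
binomialSum-suc e K x = begin
  binomialSum (suc e) (suc K) x
    ≡⟨ Σ-head K _ ⟩
  ι 1 * 1ℚ + Σ< K (λ i → ι (suc e C suc i) * x ^ℚ suc i)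
    ≡⟨ cong (ι 1 * 1ℚ +_) (Σ-cong-∀ K pascal) ⟩
  ι 1 * 1ℚ + Σ< K (λ i → x * (ι (e C i) * x ^ℚ i) + ι (e C suc i) * x ^ℚ suc i)
    ≡⟨ cong (ι 1 * 1ℚ +_) (Σ-distrib-+ K _ _) ⟩
  ι 1 * 1ℚ + (Σ< K (λ i → x * (ι (e C i) * x ^ℚ i)) + tail)
    ≡⟨ cong (λ s → ι 1 * 1ℚ + (s + tail)) (Σ-*ˡ K x _) ⟨
  ι 1 * 1ℚ + (x * binomialSum e K x + tail)
    ≡⟨ shuffle (ι 1 * 1ℚ) (x * binomialSum e K x) tail ⟩
  x * binomialSum e K x + (ι 1 * 1ℚ + tail)
    ≡⟨ cong (x * binomialSum e K x +_) (Σ-head K _) ⟨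
  x * binomialSum e K x + binomialSum e (suc K) x
    ∎
  where
  open ≡-Reasoning
  tail : ℚ
  tail = Σ< K (λ i → ι (e C suc i) * x ^ℚ suc i)
  distrib : ∀ (a b x y : ℚ) → (a + b) * (x * y) ≡ x * (a * y) + b * (x * y)
  distrib = solve-∀ ℚ-ring
  shuffle : ∀ (a b c : ℚ) → a + (b + c) ≡ b + (a + c)
  shuffle = solve-∀ ℚ-ring
  pascal : ∀ i → ι (suc e C suc i) * x ^ℚ suc i ≡ x * (ι (e C i) * x ^ℚ i) + ι (e C suc i) * x ^ℚ suc i
  pascal i = trans (cong (λ t → ι t * x ^ℚ suc i) (sym (nCk+nC[k+1]≡[n+1]C[k+1] e i)))
             (trans (cong (_* x ^ℚ suc i) (ι-+ (e C i) (e C suc i))) (distrib (ι (e C i)) (ι (e C suc i)) x (x ^ℚ i)))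

binomial : ∀ x e K → e ℕ.< K → (x + 1ℚ) ^ℚ e ≡ binomialSum e K x
binomial x zero (suc K) _ = sym (begin
  binomialSum 0 (suc K) x                                 ≡⟨ Σ-head K _ ⟩
  ι 1 * 1ℚ + Σ< K (λ i → ι (0 C suc i) * x ^ℚ suc i)      ≡⟨ cong (ι 1 * 1ℚ +_) (Σ-zero K _ vanish) ⟩
  ι 1 * 1ℚ + 0ℚ                                           ≡⟨⟩
  1ℚ                                                      ∎)
  where
  open ≡-Reasoning
  vanish : ∀ i → i ℕ.< K → ι (0 C suc i) * x ^ℚ suc i ≡ 0ℚ
  vanish i _ = trans (cong (λ t → ι t * x ^ℚ suc i) (k>n⇒nCk≡0 {0} {suc i} (s≤s z≤n))) (ℚP.*-zeroˡ (x ^ℚ suc i))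
binomial x (suc e) (suc K) (s≤s e<K) = begin
  (x + 1ℚ) * (x + 1ℚ) ^ℚ e                                  ≡⟨ ℚP.*-distribʳ-+ _ x 1ℚ ⟩
  x * (x + 1ℚ) ^ℚ e + 1ℚ * (x + 1ℚ) ^ℚ e                    ≡⟨ cong (x * (x + 1ℚ) ^ℚ e +_) (ℚP.*-identityˡ _) ⟩
  x * (x + 1ℚ) ^ℚ e + (x + 1ℚ) ^ℚ e                         ≡⟨ cong₂ (λ s t → x * s + t) (binomial x e K e<K)
                                                                 (binomial x e (suc K) (ℕP.m<n⇒m<1+n e<K)) ⟩
  x * binomialSum e K x + binomialSum e (suc K) x           ≡⟨ binomialSum-suc e K x ⟨
  binomialSum (suc e) (suc K) x                             ∎
  where open ≡-Reasoning

-- Bernoulli numbers.  Defs computes B_0 .. B_n as a vector Bs n grown by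
-- ∷ʳ; to read the recurrence off this definition we index vectors totally.

entry : ∀ {n} → Vec ℚ n → ℕ → ℚ
entry []       k       = 0ℚ
entry (x ∷ xs) zero    = x
entry (x ∷ xs) (suc k) = entry xs k

lookup≡entry : ∀ {n} (xs : Vec ℚ n) k .(k<n : k ℕ.< n) → lookup xs (fromℕ< k<n) ≡ entry xs k
lookup≡entry (x ∷ xs) zero    _   = refl
lookup≡entry (x ∷ xs) (suc k) k<n = lookup≡entry xs k (ℕ.s<s⁻¹ k<n)

entry-beyond : ∀ {n} (xs : Vec ℚ n) k → n ℕ.≤ k → entry xs k ≡ 0ℚ
entry-beyond []       k       _         = refl
entry-beyond (x ∷ xs) (suc k) (s≤s n≤k) = entry-beyond xs k n≤k

entry-∷ʳ : ∀ {n} (xs : Vec ℚ n) x k → k ℕ.< n → entry (xs ∷ʳ x) k ≡ entry xs k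
entry-∷ʳ (y ∷ xs) x zero    _         = refl
entry-∷ʳ (y ∷ xs) x (suc k) (s≤s k<n) = entry-∷ʳ xs x k k<n

entry-last : ∀ {n} (xs : Vec ℚ n) x → entry (xs ∷ʳ x) n ≡ x
entry-last []       x = refl
entry-last (y ∷ xs) x = entry-last xs x

B≡entry : ∀ n → B n ≡ entry (Bs n) n
B≡entry n = lookup≡entry (Bs n) n (ℕP.n<1+n n)

-- Later vectors extend earlier ones, so entry k of Bs n is B k whenever k ≤ n.
Bs-entry : ∀ n k → k ℕ.≤ n → entry (Bs n) k ≡ B k
Bs-entry n k k≤n = subst (λ t → entry (Bs t) k ≡ B k) (ℕP.m∸n+n≡m k≤n) (extend (n ∸ k))
  where
  extend : ∀ d → entry (Bs (d ℕ.+ k)) k ≡ B k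
  extend zero    = sym (B≡entry k)
  extend (suc d) = trans (entry-∷ʳ (Bs (d ℕ.+ k)) _ k (s≤s (ℕP.m≤n+m k d))) (extend d)

-- The step Bs (suc n) = Bs n ∷ʳ (new entry), with the lookup function used
-- by Defs for the new entry given a name.
Bs-step : ∀ n → Σ (ℕ → ℚ) λ get →
  Bs (suc n) ≡ Bs n ∷ʳ (- (1/suc (suc n) * Σ< (suc n) (λ k → ι (suc (suc n) C k) * get k)))
Bs-step n = _ , refl

Bs-step-get : ∀ n k → proj₁ (Bs-step n) k ≡ entry (Bs n) k
Bs-step-get n k with k ℕ.<? suc n
... | yes k<1+n = lookup≡entry (Bs n) k k<1+n
... | no  k≮1+n = sym (entry-beyond (Bs n) k (ℕP.≮⇒≥ k≮1+n))

B-suc : ∀ n → B (suc n) ≡ - (1/suc (suc n) * Σ< (suc n) (λ k → ι (suc (suc n) C k) * B k))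
B-suc n = trans (B≡entry (suc n)) (trans (entry-last (Bs n) _)
  (cong (λ s → - (1/suc (suc n) * s)) (Σ-cong (suc n) (λ k k<1+n →
     cong (ι (suc (suc n) C k) *_) (trans (Bs-step-get n k) (Bs-entry n k (ℕ.s≤s⁻¹ k<1+n)))))))

B-recurrence : ∀ n → Σ< (suc (suc n)) (λ k → ι (suc (suc n) C k) * B k) ≡ 0ℚ
B-recurrence n = begin
  S + ι (suc (suc n) C suc n) * B (suc n)                ≡⟨ cong₂ (λ c b → S + ι c * b) (C-suc-self (suc n)) (B-suc n) ⟩
  S + ι (suc (suc n)) * - (1/suc (suc n) * S)            ≡⟨ cong (S +_) (ℚP.neg-distribʳ-* (ι (suc (suc n))) _) ⟨
  S + - (ι (suc (suc n)) * (1/suc (suc n) * S))          ≡⟨ cong (λ t → S + - t) (ι-cancel (suc n) S) ⟩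
  S + - S                                                ≡⟨ ℚP.+-inverseʳ S ⟩
  0ℚ                                                     ∎
  where
  open ≡-Reasoning
  S : ℚ
  S = Σ< (suc n) (λ k → ι (suc (suc n) C k) * B k)

δ₁ : ℕ → ℚ
δ₁ 1 = 1ℚ
δ₁ _ = 0ℚ

Σ-δ₁ : ∀ n (f : ℕ → ℚ) → Σ< (suc (suc n)) (λ i → f i * δ₁ i) ≡ f 1
Σ-δ₁ n f = begin
  Σ< (suc (suc n)) (λ i → f i * δ₁ i)                               ≡⟨ Σ-drop-head (suc n) _ (ℚP.*-zeroʳ (f 0)) ⟩
  Σ< (suc n) (λ i → f (suc i) * δ₁ (suc i))                         ≡⟨ Σ-head n _ ⟩
  f 1 * 1ℚ + Σ< n (λ i → f (suc (suc i)) * 0ℚ)                      ≡⟨ cong₂ _+_ (ℚP.*-identityʳ (f 1))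
                                                                       (Σ-zero n _ (λ i _ → ℚP.*-zeroʳ (f (suc (suc i))))) ⟩
  f 1 + 0ℚ                                                          ≡⟨ ℚP.+-identityʳ (f 1) ⟩
  f 1                                                               ∎
  where open ≡-Reasoning

-- Σ_{r ≤ n} C(n,r) B_r = B_n + [n = 1]: the recurrence with the last term split off.
bernoulliSum : ℕ → ℚ
bernoulliSum n = Σ< (suc n) (λ r → ι (n C r) * B r)

bernoulliSum≡ : ∀ n → bernoulliSum n ≡ B n + δ₁ n
bernoulliSum≡ zero          = refl
bernoulliSum≡ (suc zero)    = refl
bernoulliSum≡ (suc (suc n)) = begin
  S + ι (suc (suc n) C suc (suc n)) * B (suc (suc n))    ≡⟨ cong₂ (λ s c → s + ι c * B (suc (suc n))) (B-recurrence n) (nCn≡1 (suc (suc n))) ⟩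
  0ℚ + 1ℚ * B (suc (suc n))                              ≡⟨ ℚP.+-identityˡ _ ⟩
  1ℚ * B (suc (suc n))                                   ≡⟨ ℚP.*-identityˡ _ ⟩
  B (suc (suc n))                                        ≡⟨ ℚP.+-identityʳ _ ⟨
  B (suc (suc n)) + 0ℚ                                   ∎
  where
  open ≡-Reasoning
  S : ℚ
  S = Σ< (suc (suc n)) (λ k → ι (suc (suc n) C k) * B k)

bernoulliPoly : ℕ → ℚ → ℚ
bernoulliPoly M x = Σ< (suc M) (λ r → ι (M C r) * B r * x ^ℚ (M ∸ r))

module _ (M : ℕ) (x : ℚ) where

  -- the terms C(M,r) C(M-r,j) B_r x^j of B_M(x+1) after binomial expansion
  expanded : ℕ → ℕ → ℚ
  expanded r j = ι (M C r) * ι ((M ∸ r) C j) * B r * x ^ℚ j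

  bernoulliPoly-expand : bernoulliPoly M (x + 1ℚ) ≡ Σ< (suc M) (λ r → Σ< (suc M) (expanded r))
  bernoulliPoly-expand = Σ-cong-∀ (suc M) (λ r →
    trans (cong (ι (M C r) * B r *_) (binomial x (M ∸ r) (suc M) (s≤s (ℕP.m∸n≤m M r))))
    (trans (Σ-*ˡ (suc M) (ι (M C r) * B r) _)
           (Σ-cong-∀ (suc M) (λ j → regroup (ι (M C r)) (B r) (ι ((M ∸ r) C j)) (x ^ℚ j)))))
    where
    regroup : ∀ (a b c d : ℚ) → (a * b) * (c * d) ≡ a * c * b * d
    regroup = solve-∀ ℚ-ring

  expanded-column : ∀ j → j ℕ.< suc M →
    Σ< (suc M) (λ r → expanded r j) ≡ ι (M C j) * x ^ℚ j * bernoulliSum (M ∸ j)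
  expanded-column j _ = begin
    Σ< (suc M) (λ r → expanded r j)
      ≡⟨ Σ-cong-∀ (suc M) (λ r → trans (cong (λ c → c * B r * x ^ℚ j) (swapped r))
                                   (regroup (ι (M C j)) (ι ((M ∸ j) C r)) (B r) (x ^ℚ j))) ⟩
    Σ< (suc M) (λ r → ι (M C j) * x ^ℚ j * (ι ((M ∸ j) C r) * B r))
      ≡⟨ Σ-*ˡ (suc M) (ι (M C j) * x ^ℚ j) (λ r → ι ((M ∸ j) C r) * B r) ⟨
    ι (M C j) * x ^ℚ j * Σ< (suc M) (λ r → ι ((M ∸ j) C r) * B r)
      ≡⟨ cong (ι (M C j) * x ^ℚ j *_) (Σ-extend (suc (M ∸ j)) (suc M) _ (s≤s (ℕP.m∸n≤m M j)) beyond) ⟩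
    ι (M C j) * x ^ℚ j * bernoulliSum (M ∸ j)
      ∎
    where
    open ≡-Reasoning
    regroup : ∀ (a b c d : ℚ) → a * b * c * d ≡ a * d * (b * c)
    regroup = solve-∀ ℚ-ring
    swapped : ∀ r → ι (M C r) * ι ((M ∸ r) C j) ≡ ι (M C j) * ι ((M ∸ j) C r)
    swapped r = trans (sym (ι-* (M C r) _)) (trans (cong ι (C-C-swap M r j)) (ι-* (M C j) _))
    beyond : ∀ r → suc (M ∸ j) ℕ.≤ r → ι ((M ∸ j) C r) * B r ≡ 0ℚ
    beyond r M∸j<r = trans (cong (λ c → ι c * B r) (k>n⇒nCk≡0 M∸j<r)) (ℚP.*-zeroˡ (B r))

  reflected-column : ∀ i → i ℕ.< suc M →
    ι (M C (M ∸ i)) * x ^ℚ (M ∸ i) * bernoulliSum (M ∸ (M ∸ i))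
      ≡ ι (M C i) * B i * x ^ℚ (M ∸ i) + ι (M C i) * x ^ℚ (M ∸ i) * δ₁ i
  reflected-column i i<1+M = begin
    ι (M C (M ∸ i)) * x ^ℚ (M ∸ i) * bernoulliSum (M ∸ (M ∸ i))
      ≡⟨ cong₂ (λ c k → ι c * x ^ℚ (M ∸ i) * bernoulliSum k) (sym (nCk≡nC[n∸k] i≤M)) (ℕP.m∸[m∸n]≡n i≤M) ⟩
    ι (M C i) * x ^ℚ (M ∸ i) * bernoulliSum i
      ≡⟨ cong (ι (M C i) * x ^ℚ (M ∸ i) *_) (bernoulliSum≡ i) ⟩
    ι (M C i) * x ^ℚ (M ∸ i) * (B i + δ₁ i)
      ≡⟨ split (ι (M C i)) (B i) (x ^ℚ (M ∸ i)) (δ₁ i) ⟩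
    ι (M C i) * B i * x ^ℚ (M ∸ i) + ι (M C i) * x ^ℚ (M ∸ i) * δ₁ i
      ∎
    where
    open ≡-Reasoning
    i≤M : i ℕ.≤ M
    i≤M = ℕ.s≤s⁻¹ i<1+M
    split : ∀ (a b y d : ℚ) → a * y * (b + d) ≡ a * b * y + a * y * d
    split = solve-∀ ℚ-ring

-- The difference equation B_M(x+1) = B_M(x) + M x^{M-1} for M ≥ 1: expand
-- (x+1)^{M-r} binomially, exchange the sums, collapse each column by the
-- Bernoulli recurrence, and reverse the order of the columns.
bernoulliPoly-shift : ∀ N x → bernoulliPoly (suc N) (x + 1ℚ) ≡ bernoulliPoly (suc N) x + ι (suc N) * x ^ℚ N
bernoulliPoly-shift N x = begin
  bernoulliPoly M (x + 1ℚ)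
    ≡⟨ bernoulliPoly-expand M x ⟩
  Σ< K (λ r → Σ< K (expanded M x r))
    ≡⟨ Σ-swap K K (expanded M x) ⟩
  Σ< K (λ j → Σ< K (λ r → expanded M x r j))
    ≡⟨ Σ-cong K (expanded-column M x) ⟩
  Σ< K (λ j → ι (M C j) * x ^ℚ j * bernoulliSum (M ∸ j))
    ≡⟨ Σ-reverse K (λ j → ι (M C j) * x ^ℚ j * bernoulliSum (M ∸ j)) ⟩
  Σ< K (λ i → ι (M C (M ∸ i)) * x ^ℚ (M ∸ i) * bernoulliSum (M ∸ (M ∸ i)))
    ≡⟨ Σ-cong K (reflected-column M x) ⟩
  Σ< K (λ i → ι (M C i) * B i * x ^ℚ (M ∸ i) + ι (M C i) * x ^ℚ (M ∸ i) * δ₁ i)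
    ≡⟨ Σ-distrib-+ K (λ i → ι (M C i) * B i * x ^ℚ (M ∸ i)) (λ i → ι (M C i) * x ^ℚ (M ∸ i) * δ₁ i) ⟩
  bernoulliPoly M x + Σ< K (λ i → ι (M C i) * x ^ℚ (M ∸ i) * δ₁ i)
    ≡⟨ cong (bernoulliPoly M x +_) (Σ-δ₁ N (λ i → ι (M C i) * x ^ℚ (M ∸ i))) ⟩
  bernoulliPoly M x + ι (M C 1) * x ^ℚ N
    ≡⟨ cong (λ c → bernoulliPoly M x + ι c * x ^ℚ N) (nC1≡n M) ⟩
  bernoulliPoly M x + ι M * x ^ℚ N
    ∎
  where
  open ≡-Reasoning
  M K : ℕ
  M = suc N
  K = suc M

-- Faulhaber's formula.  With
--   Φ m y = B_{m+1}(y) - B_{m+1} = Σ_{r ≤ m} C(m+1,r) B_r y^{m+1-r},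
-- we have Σ_{k < n} k^m = Φ m n / (m+1).
Φ : ℕ → ℚ → ℚ
Φ m y = Σ< (suc m) (λ r → ι (suc m C r) * B r * y ^ℚ (suc m ∸ r))

bernoulliPoly≡Φ : ∀ m y → bernoulliPoly (suc m) y ≡ Φ m y + ι (suc m C suc m) * B (suc m) * 1ℚ
bernoulliPoly≡Φ m y = cong (λ e → Φ m y + ι (suc m C suc m) * B (suc m) * y ^ℚ e) (ℕP.n∸n≡0 m)

Φ-shift : ∀ m y → Φ m (y + 1ℚ) ≡ Φ m y + ι (suc m) * y ^ℚ m
Φ-shift m y = +-Group.∙-cancelʳ c (Φ m (y + 1ℚ)) (Φ m y + ι (suc m) * y ^ℚ m) (begin
  Φ m (y + 1ℚ) + c                       ≡⟨ bernoulliPoly≡Φ m (y + 1ℚ) ⟨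
  bernoulliPoly (suc m) (y + 1ℚ)         ≡⟨ bernoulliPoly-shift m y ⟩
  bernoulliPoly (suc m) y + t            ≡⟨ cong (_+ t) (bernoulliPoly≡Φ m y) ⟩
  Φ m y + c + t                          ≡⟨ swap-last (Φ m y) c t ⟩
  Φ m y + t + c                          ∎)
  where
  open ≡-Reasoning
  c t : ℚ
  c = ι (suc m C suc m) * B (suc m) * 1ℚ
  t = ι (suc m) * y ^ℚ m
  swap-last : ∀ (a b d : ℚ) → a + b + d ≡ a + d + b
  swap-last = solve-∀ ℚ-ring

-- 0^e = 0 for e > 0; this makes Φ_m vanish at 0 and the term k = 0 drop from power sums.
0^pos : ∀ e → 0 ℕ.< e → ι 0 ^ℚ e ≡ 0ℚ
0^pos (suc e) _ = ℚP.*-zeroˡ (ι 0 ^ℚ e)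

Φ-at-0 : ∀ m → Φ m (ι 0) ≡ 0ℚ
Φ-at-0 m = Σ-zero (suc m) _ (λ r r≤m → trans
  (cong (ι (suc m C r) * B r *_) (0^pos (suc m ∸ r) (ℕP.m<n⇒0<n∸m r≤m))) (ℚP.*-zeroʳ (ι (suc m C r) * B r)))

Φ-factor : ∀ m y → Φ m y ≡ y * Σ< (suc m) (λ r → ι (suc m C r) * B r * y ^ℚ (m ∸ r))
Φ-factor m y = trans (Σ-cong (suc m) (λ r r≤m → trans
    (cong (λ e → ι (suc m C r) * B r * y ^ℚ e) (ℕP.+-∸-assoc 1 (ℕ.s≤s⁻¹ r≤m)))
    (pull-out (ι (suc m C r) * B r) y (y ^ℚ (m ∸ r)))))
  (sym (Σ-*ˡ (suc m) y _))
  where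
  pull-out : ∀ (c y z : ℚ) → c * (y * z) ≡ y * (c * z)
  pull-out = solve-∀ ℚ-ring

-- Faulhaber's formula, by telescoping Φ-shift.
faulhaber : ∀ m n → Σ< n (λ k → ι k ^ℚ m) ≡ 1/suc m * Φ m (ι n)
faulhaber m zero    = sym (trans (cong (1/suc m *_) (Φ-at-0 m)) (ℚP.*-zeroʳ (1/suc m)))
faulhaber m (suc n) = begin
  Σ< n (λ k → ι k ^ℚ m) + ι n ^ℚ m                          ≡⟨ cong (_+ ι n ^ℚ m) (faulhaber m n) ⟩
  1/suc m * Φ m (ι n) + ι n ^ℚ m                            ≡⟨ cong (1/suc m * Φ m (ι n) +_) (1/suc-cancel m (ι n ^ℚ m)) ⟨
  1/suc m * Φ m (ι n) + 1/suc m * (ι (suc m) * ι n ^ℚ m)    ≡⟨ ℚP.*-distribˡ-+ (1/suc m) _ _ ⟨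
  1/suc m * (Φ m (ι n) + ι (suc m) * ι n ^ℚ m)              ≡⟨ cong (1/suc m *_) (Φ-shift m (ι n)) ⟨
  1/suc m * Φ m (ι n + 1ℚ)                                  ≡⟨ cong (λ y → 1/suc m * Φ m y) (ι-suc n) ⟨
  1/suc m * Φ m (ι (suc n))                                 ∎
  where open ≡-Reasoning

module _ (m : ℕ) where

  S : ℕ → ℚ
  S k = Σ< k (λ j → ι j ^ℚ m)

  -- W r i = C(m+1,r) B_r (i+1)^{m-r}: by Faulhaber, S(i+1)/(i+1) = Σ_{r ≤ m} W r i / (m+1)
  W : ℕ → ℕ → ℚ
  W r i = ι (suc m C r) * B r * ι (suc i) ^ℚ (m ∸ r)

  S/suc : ∀ i → 1/suc i * S (suc i) ≡ 1/suc m * Σ< (suc m) (λ r → W r i)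
  S/suc i = begin
    1/suc i * S (suc i)                                  ≡⟨ cong (1/suc i *_) (faulhaber m (suc i)) ⟩
    1/suc i * (1/suc m * Φ m (ι (suc i)))                ≡⟨ cong (λ φ → 1/suc i * (1/suc m * φ)) (Φ-factor m (ι (suc i))) ⟩
    1/suc i * (1/suc m * (ι (suc i) * ΣW))               ≡⟨ swap-front (1/suc i) (1/suc m) _ ⟩
    1/suc m * (1/suc i * (ι (suc i) * ΣW))               ≡⟨ cong (1/suc m *_) (1/suc-cancel i ΣW) ⟩
    1/suc m * ΣW                                         ∎
    where
    open ≡-Reasoning
    ΣW : ℚ
    ΣW = Σ< (suc m) (λ r → W r i)
    swap-front : ∀ (a b c : ℚ) → a * (b * c) ≡ b * (a * c)
    swap-front = solve-∀ ℚ-ring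

  Σ-W-last : ∀ n → Σ< n (W m) ≡ ι (suc m) * (ι n * B m)
  Σ-W-last n = begin
    Σ< n (W m)                             ≡⟨ Σ-cong-∀ n (λ i → cong₂ (λ c e → ι c * B m * ι (suc i) ^ℚ e) (C-suc-self m) (ℕP.n∸n≡0 m)) ⟩
    Σ< n (λ _ → ι (suc m) * B m * 1ℚ)      ≡⟨ Σ-const n _ ⟩
    ι n * (ι (suc m) * B m * 1ℚ)           ≡⟨ rearrange (ι n) (ι (suc m)) (B m) ⟩
    ι (suc m) * (ι n * B m)                ∎
    where
    open ≡-Reasoning
    rearrange : ∀ (a c b : ℚ) → a * (c * b * 1ℚ) ≡ c * (a * b)
    rearrange = solve-∀ ℚ-ring

  -- the double sum in the theorem, for fixed r
  Y : ℕ → ℕ → ℚ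
  Y p r = Σ< (suc (m ∸ r)) (λ l →
            ι (suc m C r) * ι ((suc m ∸ r) C l) * 1/suc (m ∸ r)
              * B r * B l * (ι p ^ℚ (suc m ∸ r ∸ l)))

  -- for r < m, Faulhaber's formula with exponent m - r evaluates Σ_i W r i
  Σ-W-mid : ∀ n r → r ℕ.< m → Σ< n (W r) ≡ Y (suc n) r
  Σ-W-mid n r r<m = begin
    Σ< n (W r)
      ≡⟨ Σ-*ˡ n c (λ i → ι (suc i) ^ℚ e) ⟨
    c * Σ< n (λ i → ι (suc i) ^ℚ e)
      ≡⟨ cong (c *_) (Σ-drop-head n (λ k → ι k ^ℚ e) (0^pos e (ℕP.m<n⇒0<n∸m r<m))) ⟨
    c * S′ (suc n)
      ≡⟨ cong (c *_) (faulhaber e (suc n)) ⟩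
    c * (1/suc e * Φ e y)
      ≡⟨ cong (c *_) (Σ-*ˡ (suc e) (1/suc e) _) ⟩
    c * Σ< (suc e) (λ l → 1/suc e * (ι (suc e C l) * B l * y ^ℚ (suc e ∸ l)))
      ≡⟨ Σ-*ˡ (suc e) c _ ⟩
    Σ< (suc e) (λ l → c * (1/suc e * (ι (suc e C l) * B l * y ^ℚ (suc e ∸ l))))
      ≡⟨ Σ-cong-∀ (suc e) term ⟩
    Y (suc n) r
      ∎
    where
    open ≡-Reasoning
    e : ℕ
    e = m ∸ r
    c y : ℚ
    c = ι (suc m C r) * B r
    y = ι (suc n)
    S′ : ℕ → ℚ
    S′ k = Σ< k (λ j → ι j ^ℚ e)
    rearrange : ∀ (a b d g bl z : ℚ) → a * b * (d * (g * bl * z)) ≡ a * g * d * b * bl * z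
    rearrange = solve-∀ ℚ-ring
    term : ∀ l → c * (1/suc e * (ι (suc e C l) * B l * y ^ℚ (suc e ∸ l)))
               ≡ ι (suc m C r) * ι ((suc m ∸ r) C l) * 1/suc e * B r * B l * (y ^ℚ (suc m ∸ r ∸ l))
    term l = trans (rearrange (ι (suc m C r)) (B r) (1/suc e) (ι (suc e C l)) (B l) (y ^ℚ (suc e ∸ l)))
      (cong (λ t → ι (suc m C r) * ι (t C l) * 1/suc e * B r * B l * (y ^ℚ (t ∸ l)))
            (sym (ℕP.+-∸-assoc 1 (ℕP.<⇒≤ r<m))))

  Σ-S/suc : ∀ n → Σ< n (λ i → 1/suc i * S (suc i)) ≡ 1/suc m * (Σ< m (Y (suc n)) + ι (suc m) * (ι n * B m))
  Σ-S/suc n = begin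
    Σ< n (λ i → 1/suc i * S (suc i))
      ≡⟨ Σ-cong-∀ n S/suc ⟩
    Σ< n (λ i → 1/suc m * Σ< (suc m) (λ r → W r i))
      ≡⟨ Σ-*ˡ n (1/suc m) _ ⟨
    1/suc m * Σ< n (λ i → Σ< (suc m) (λ r → W r i))
      ≡⟨ cong (1/suc m *_) (Σ-swap n (suc m) (λ i r → W r i)) ⟩
    1/suc m * (Σ< m (λ r → Σ< n (W r)) + Σ< n (W m))
      ≡⟨ cong (1/suc m *_) (cong₂ _+_ (Σ-cong m (λ r r<m → Σ-W-mid n r r<m)) (Σ-W-last n)) ⟩
    1/suc m * (Σ< m (Y (suc n)) + ι (suc m) * (ι n * B m))
      ∎
    where open ≡-Reasoning

  power-harmonic-sum : ∀ n →
    Σ< n (λ i → ι (suc i) ^ℚ m * H (suc i))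
      ≡ (H n * 1/suc m) * Φ m (ι (suc n)) - ι n * B m - 1/suc m * Σ< m (Y (suc n))
  power-harmonic-sum n = begin
    Σ< n (λ i → ι (suc i) ^ℚ m * H (suc i))
      ≡⟨ abel (λ k → ι k ^ℚ m) H refl n ⟩
    H n * S (suc n) - Σ< n (λ i → (H (suc i) - H i) * S (suc i))
      ≡⟨ cong₂ (λ s t → H n * s - t) (faulhaber m (suc n))
               (Σ-cong-∀ n (λ i → cong (_* S (suc i)) (increment (H i) (1/suc i)))) ⟩
    H n * (1/suc m * φ) - Σ< n (λ i → 1/suc i * S (suc i))
      ≡⟨ cong (λ t → H n * (1/suc m * φ) - t) (Σ-S/suc n) ⟩
    H n * (1/suc m * φ) - 1/suc m * (ΣY + ι (suc m) * (ι n * B m))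
      ≡⟨ cong (λ t → H n * (1/suc m * φ) - t)
              (trans (ℚP.*-distribˡ-+ (1/suc m) ΣY _) (cong (1/suc m * ΣY +_) (1/suc-cancel m (ι n * B m)))) ⟩
    H n * (1/suc m * φ) - (1/suc m * ΣY + ι n * B m)
      ≡⟨ rearrange (H n) (1/suc m) φ ΣY (ι n * B m) ⟩
    (H n * 1/suc m) * φ - ι n * B m - 1/suc m * ΣY
      ∎
    where
    open ≡-Reasoning
    φ ΣY : ℚ
    φ = Φ m (ι (suc n))
    ΣY = Σ< m (Y (suc n))
    increment : ∀ (h d : ℚ) → (h + d) - h ≡ d
    increment = solve-∀ ℚ-ring
    rearrange : ∀ (h a φ y t : ℚ) → h * (a * φ) - (a * y + t) ≡ (h * a) * φ - t - a * y
    rearrange = solve-∀ ℚ-ring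

-- For m, p ≥ 1 the sums of the statement unfold definitionally to those of
-- power-harmonic-sum with p = n + 1.
lemma2p1 : (m p : ℕ) → m ≥ 1 → p ≥ 1 →
    Σ[ 1 to p ∸ 1 ] (λ k → (ℕ→ℚ k ^ℚ m) * H k)
      ≡ (H (p ∸ 1) * 1/suc m)
          * Σ[ 0 to m ] (λ r → ℕ→ℚ (suc m C r) * B r * (ℕ→ℚ p ^ℚ (suc m ∸ r)))
        - ℕ→ℚ (p ∸ 1) * B m
        - 1/suc m
          * Σ[ 0 to m ∸ 1 ] (λ r → Σ[ 0 to m ∸ r ] (λ l →
              ℕ→ℚ (suc m C r) * ℕ→ℚ ((suc m ∸ r) C l) * 1/suc (m ∸ r)
                * B r * B l * (ℕ→ℚ p ^ℚ (suc m ∸ r ∸ l))))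
lemma2p1 (suc m) (suc n) _ _ = power-harmonic-sum (suc m) n
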